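{- Let $m,n\ge 3$ and let $S$ be a self-identifying code of $K_m\times P_n$. Then $|C_1\cap S|\ge 3$ and $|C_{n-2}\cap S|\ge 3$.
   Context: For a vertex $v$, $N[v]$ is its closed neighborhood. A nonempty set $S\subseteq V(G)$ is a self-identifying code of $G$ if for every vertex $v\in V(G)$: (1) $N[v]\cap S\neq\emptyset$, and (2) $\bigcap_{c\in N[v]\cap S}N[c]=\{v\}$. With $V(K_m)=\{v_0,\dots,v_{m-1}\}$ and $V(P_n)=\{0,\dots,n-1\}$ (consecutively numbered path), $K_m\times P_n$ has vertices $(v_i,j)$, with $(v_i,j)$ adjacent to $(v_{i'},j')$ iff $i\neq i'$ and $|j-j'|=1$. The $j$-th column is $C_j=\{(v_i,j):0\le i\le m-1\}$. -}

module Defs where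

open import Data.Nat using (ℕ; suc)
open import Data.Fin using (Fin; toℕ)
open import Data.Bool using (Bool; true)
open import Data.Product using (_×_; _,_; ∃)
open import Data.Sum using (_⊎_)
open import Data.List using (List; length; filterᵇ; allFin)
open import Relation.Binary.PropositionalEquality using (_≡_; _≢_)

Vertex : ℕ → ℕ → Set
Vertex m n = Fin m × Fin n

PathAdj : {n : ℕ} → Fin n → Fin n → Set
PathAdj j j' = suc (toℕ j) ≡ toℕ j' ⊎ suc (toℕ j') ≡ toℕ j

Adj : {m n : ℕ} → Vertex m n → Vertex m n → Set
Adj (i , j) (i' , j') = i ≢ i' × PathAdj j j'

-- InN v u  means  u ∈ N[v]  (closed neighbourhood)
InN : {m n : ℕ} → Vertex m n → Vertex m n → Set
InN v u = u ≡ v ⊎ Adj v u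

VSet : ℕ → ℕ → Set
VSet m n = Vertex m n → Bool

_∈S_ : {m n : ℕ} → Vertex m n → VSet m n → Set
v ∈S S = S v ≡ true

InCodeIntersection : {m n : ℕ} → VSet m n → Vertex m n → Vertex m n → Set
InCodeIntersection S v w = ∀ c → InN v c → c ∈S S → InN c w

record SelfIdentifying {m n : ℕ} (S : VSet m n) : Set where
  field
    nonempty    : ∃ λ v → v ∈S S
    dominating  : ∀ v → ∃ λ c → InN v c × c ∈S S
    contains-v  : ∀ v → InCodeIntersection S v v
    only-v      : ∀ v w → InCodeIntersection S v w → w ≡ v

columnCount : {m n : ℕ} → VSet m n → Fin n → ℕ
columnCount {m} S j = length (filterᵇ (λ i → S (i , j)) (allFin m))

-- Let column b be the only neighbour of an end column e, and suppose at most two code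
-- vertices lie in column b, so their rows are among some i and k ≠ i. Every codeword in
-- N[(i , e)] is either (i , e) itself or lies in column b off row i, hence in row k; each of
-- them dominates (k , b). So (k , b) lies in the intersection identifying (i , e), which is
-- impossible since b ≠ e.
module Submission where

open import Defs
open import Data.Nat using (ℕ; suc; _≤_; _<_; _∸_; s≤s; s≤s⁻¹)
open import Data.Nat.Properties using (<⇒≤; <-irrefl; ≮⇒≥; 1+n≢n; suc-injective)
open import Data.Fin using (Fin; toℕ; fromℕ; fromℕ<)
open import Data.Fin.Properties using (toℕ-injective; toℕ-fromℕ; toℕ-fromℕ<; toℕ<n; _≟_)
open import Data.Bool.Properties using (T-≡; T?)
open import Data.Product using (_×_; _,_; ∃; ∃₂; proj₁; proj₂)
open import Data.Empty using (⊥-elim)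
open import Data.Sum using (_⊎_; inj₁; inj₂)
open import Data.List using (List; []; _∷_; length; filterᵇ; allFin)
open import Data.List.Membership.Propositional using (_∈_)
open import Data.List.Membership.Propositional.Properties using (∈-filter⁺; ∈-allFin)
open import Data.List.Relation.Unary.Any using (here; there)
open import Function using (_∘_)
open import Function.Bundles using (Equivalence)
open import Relation.Nullary using (yes; no)
open import Relation.Binary.PropositionalEquality using (_≡_; _≢_; refl; sym; trans; cong)

CoveredBy : ∀ {m} → Fin m → Fin m → List (Fin m) → Set
CoveredBy i k L = ∀ {l} → l ∈ L → l ≡ i ⊎ l ≡ k

∃-≢ : ∀ {m} → 2 ≤ m → (a : Fin m) → ∃ λ k → k ≢ a
∃-≢ (s≤s (s≤s _)) Fin.zero    = Fin.suc Fin.zero , λ ()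
∃-≢ (s≤s (s≤s _)) (Fin.suc _) = Fin.zero , λ ()

pair-coveredBy : ∀ {m} → 2 ≤ m → (a b : Fin m) →
  ∃₂ λ i k → k ≢ i × CoveredBy i k (a ∷ b ∷ [])
pair-coveredBy 2≤m a b with b ≟ a | ∃-≢ 2≤m a
... | no b≢a   | _         = a , b , b≢a , λ { (here refl) → inj₁ refl ; (there (here refl)) → inj₂ refl }
... | yes refl | (k , k≢a) = a , k , k≢a , λ { (here refl) → inj₁ refl ; (there (here refl)) → inj₁ refl }

short-list-coveredBy : ∀ {m} → 2 ≤ m → (L : List (Fin m)) → length L ≤ 2 →
  ∃₂ λ i k → k ≢ i × CoveredBy i k L
short-list-coveredBy 2≤m@(s≤s _) [] _ with pair-coveredBy 2≤m Fin.zero Fin.zero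
... | i , k , k≢i , _ = i , k , k≢i , λ ()
short-list-coveredBy 2≤m (a ∷ []) _ with pair-coveredBy 2≤m a a
... | i , k , k≢i , covered = i , k , k≢i , λ { (here refl) → covered (here refl) }
short-list-coveredBy 2≤m (a ∷ b ∷ []) _ = pair-coveredBy 2≤m a b
short-list-coveredBy 2≤m (_ ∷ _ ∷ _ ∷ _) (s≤s (s≤s ()))

codeRows : ∀ {m n} → VSet m n → Fin n → List (Fin m)
codeRows {m} S j = filterᵇ (λ i → S (i , j)) (allFin m)

∈-codeRows : ∀ {m n} (S : VSet m n) (j : Fin n) {l : Fin m} → (l , j) ∈S S → l ∈ codeRows S j
∈-codeRows S j {l} l∈S = ∈-filter⁺ (T? ∘ λ i → S (i , j)) (∈-allFin l) (Equivalence.from T-≡ l∈S)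

OnlyNeighbour : ∀ {n} → Fin n → Fin n → Set
OnlyNeighbour e b = PathAdj e b × (∀ j → PathAdj e j → j ≡ b)

pathAdj-irrefl : ∀ {n} {e b : Fin n} → PathAdj e b → b ≢ e
pathAdj-irrefl (inj₁ e+1≡e) refl = 1+n≢n e+1≡e
pathAdj-irrefl (inj₂ b+1≡b) refl = 1+n≢n b+1≡b

onlyNeighbour-first : ∀ {n} → OnlyNeighbour {suc (suc n)} Fin.zero (Fin.suc Fin.zero)
onlyNeighbour-first = inj₁ refl , only
  where
  only : ∀ j → PathAdj Fin.zero j → j ≡ Fin.suc Fin.zero
  only (Fin.suc Fin.zero)     _        = refl
  only Fin.zero               (inj₁ ())
  only Fin.zero               (inj₂ ())
  only (Fin.suc (Fin.suc _)) (inj₁ ())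
  only (Fin.suc (Fin.suc _)) (inj₂ ())

onlyNeighbour-last : ∀ {n} {b : Fin (suc n)} → suc (toℕ b) ≡ n → OnlyNeighbour (fromℕ n) b
onlyNeighbour-last {n} {b} b+1≡n = inj₂ (trans b+1≡n (sym (toℕ-fromℕ n))) , only
  where
  only : ∀ j → PathAdj (fromℕ n) j → j ≡ b
  only j (inj₁ n+1≡j) = ⊥-elim (<-irrefl (trans (sym n+1≡j) (cong suc (toℕ-fromℕ n))) (toℕ<n j))
  only j (inj₂ j+1≡n) = toℕ-injective (suc-injective (trans j+1≡n (trans (toℕ-fromℕ n) (sym b+1≡n))))

codeIntersection-beside-end : ∀ {m n} {S : VSet m n} {e b : Fin n} {i k : Fin m} →
  OnlyNeighbour e b → k ≢ i → (∀ {l} → (l , b) ∈S S → l ≡ i ⊎ l ≡ k) →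
  InCodeIntersection S (i , e) (k , b)
codeIntersection-beside-end (e~b , _) k≢i _ _ (inj₁ refl) _ = inj₂ (k≢i ∘ sym , e~b)
codeIntersection-beside-end (_ , only-b) k≢i rows (l , j) (inj₂ (i≢l , e~j)) c∈S
  with only-b j e~j
... | refl with rows c∈S
...   | inj₁ refl = ⊥-elim (i≢l refl)
...   | inj₂ refl = inj₁ refl

3≤columnCount-beside-end : ∀ {m n} {S : VSet m n} {e b : Fin n} → 2 ≤ m → SelfIdentifying S →
  OnlyNeighbour e b → 3 ≤ columnCount S b
3≤columnCount-beside-end {S = S} {e} {b} 2≤m code only = ≮⇒≥ λ count<3 →
  let i , k , k≢i , covered = short-list-coveredBy 2≤m (codeRows S b) (s≤s⁻¹ count<3)
      confused = codeIntersection-beside-end only k≢i (λ l∈S → covered (∈-codeRows S b l∈S))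
  in pathAdj-irrefl (proj₁ only) (cong proj₂ (SelfIdentifying.only-v code (i , e) (k , b) confused))

corollary9 : (m n : ℕ) → 3 ≤ m → (n3 : 3 ≤ n) → (S : VSet m n) → SelfIdentifying S →
    (p1 : 1 < n) → (p2 : n ∸ 2 < n) →
    3 ≤ columnCount S (fromℕ< p1) × 3 ≤ columnCount S (fromℕ< p2)
corollary9 m _ 3≤m (s≤s (s≤s (s≤s _))) S code _ p2 =
  3≤columnCount-beside-end 2≤m code onlyNeighbour-first ,
  3≤columnCount-beside-end 2≤m code (onlyNeighbour-last (cong suc (toℕ-fromℕ< p2)))
  where
  2≤m : 2 ≤ m
  2≤m = <⇒≤ 3≤m
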